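{- Let $M=\{1^{p_1},\dots,n^{p_n}\}$ be a multiset with $p_1,\dots,p_n$ positive integers, and let $d\ge0$ be an integer. Then $$\sum_{T\in\mathcal{T}_M}\#\{\text{nodes of } T \text{ with full-degree } 2d+1\}=2\sum_{T\in\mathcal{T}_M}\#\{\text{nodes of } T\text{ with degree } 2d+1\}.$$
   Context: A plane tree is a rooted tree in which the children of every node are linearly ordered. With $p=\sum p_i$, a weakly increasing tree on $M$ is a plane tree with $p+1$ nodes labeled by the elements of the multiset $M\cup\{0\}$ (with multiplicity) such that labels weakly increase along every root-to-leaf path and the labels of the children of each node weakly increase from left to right. $\mathcal{T}_M$ is the set of such trees. The degree of a node is its number of children. The full-degree of a node $v$ is the number of nodes adjacent to $v$ (its degree plus one, unless $v$ is the root, in which case it equals its degree). -}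

module Defs where

open import Data.Nat using (ℕ; zero; suc; _≤_; _≟_)
open import Data.Fin using (Fin; toℕ)
open import Data.List using (List; []; _∷_; _++_; map; replicate; concatMap; allFin; length; filter)
open import Data.List.Relation.Unary.All using (All)
open import Data.List.Relation.Unary.Linked using (Linked)
open import Data.List.Relation.Binary.Permutation.Propositional using (_↭_)
open import Relation.Binary.PropositionalEquality using (_≡_)

data Tree : Set where
  node : ℕ → List Tree → Tree

label : Tree → ℕ
label (node a _) = a

children : Tree → List Tree
children (node _ ts) = ts

degree : Tree → ℕ
degree t = length (children t)

mutual
  labels : Tree → List ℕ
  labels (node a ts) = a ∷ labelsF ts

  labelsF : List Tree → List ℕ
  labelsF [] = []
  labelsF (t ∷ ts) = labels t ++ labelsF ts

mutual
  degrees : Tree → List ℕ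
  degrees (node a ts) = length ts ∷ degreesF ts

  degreesF : List Tree → List ℕ
  degreesF [] = []
  degreesF (t ∷ ts) = degrees t ++ degreesF ts

fullDegrees : Tree → List ℕ
fullDegrees (node a ts) = length ts ∷ map suc (degreesF ts)

#deg : ℕ → Tree → ℕ
#deg k t = length (filter (_≟ k) (degrees t))

#fullDeg : ℕ → Tree → ℕ
#fullDeg k t = length (filter (_≟ k) (fullDegrees t))

data WeaklyIncreasing : Tree → Set where
  wi : ∀ {a ts} →
       All (λ t → a ≤ label t) ts →
       Linked _≤_ (map label ts) →
       All WeaklyIncreasing ts →
       WeaklyIncreasing (node a ts)

-- the multiset M = {1^{p 1}, ..., n^{p n}} as a list (label i+1 for index i : Fin n)
multiset : (n : ℕ) → (Fin n → ℕ) → List ℕ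
multiset n p = concatMap (λ i → replicate (p i) (suc (toℕ i))) (allFin n)

InTM : (n : ℕ) → (Fin n → ℕ) → Tree → Set
InTM n p t = WeaklyIncreasing t × (labels t ↭ (0 ∷ multiset n p))
  where open import Data.Product using (_×_)

-- Read a forest in the left-child/right-sibling way: its first tree node a cs
-- is a binary node whose two subtrees are the children cs and the younger
-- siblings.  Exchanging these two subtrees at any set of binary nodes keeps
-- labels weakly increasing along binary edges, which is exactly the
-- weak-increase condition of 𝒯_M, so the group of such exchanges acts on 𝒯_M
-- and any statistic may be averaged over it.  Summed over the 2 choices at
-- the root of a binary tree with subtrees A and B, the nodes of degree k
-- number δ_k(A) + δ_k(B) + 2(c_k(A) + c_k(B)), where c_k counts nodes of degree
-- k and δ_k(F) = [F has k trees]; by induction this makes the orbit sum of c_k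
-- equal to that of δ_{k+1} + 2 c_{k+1}.  As the root has full-degree k + 1
-- iff it has degree k + 1 and every other node has full-degree k + 1 iff it
-- has degree k, the orbit sums of the two statistics differ by a factor 2.
module Submission where

open import Defs
open import Algebra.Properties.CommutativeSemigroup using (interchange)
open import Data.Bool using (Bool; true; false)
open import Data.Nat using (ℕ; zero; suc; _≤_; _+_; _*_; _⊔_; _≟_; z≤n; s≤s; NonZero; >-nonZero)
open import Data.Nat.Properties
  using (+-comm; *-comm; *-identityʳ; *-distribˡ-+; *-cancelˡ-≡; +-commutativeSemigroup; suc-injective;
         ≤-refl; ≤-trans; ≤-reflexive; m≤m+n; ⊔-mono-≤; m⊔n≤m+n; m⊔n≤o⇒m≤o; m⊔n≤o⇒n≤o)
open import Data.Nat.Tactic.RingSolver using (solve-∀)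
open import Data.Fin using (Fin)
open import Data.List using (List; []; _∷_; _++_; [_]; map; length; filter)
open import Data.List.Properties using (filter-++; length-++; map-∘; map-cong-local)
open import Data.Nat.ListAction using (sum)
open import Data.Nat.ListAction.Properties using (sum-↭)
open import Data.List.Membership.Propositional using (_∈_)
open import Data.List.Membership.Propositional.Properties using (∈-map⁺; ∈-map⁻)
open import Data.List.Membership.Propositional.Properties.WithK using (unique∧set⇒bag)
open import Data.List.Relation.Unary.All using (All; []; _∷_)
import Data.List.Relation.Unary.All as All
import Data.List.Relation.Unary.All.Properties as All
open import Data.List.Relation.Unary.Linked using (Linked; []; [-]; _∷_)
import Data.List.Relation.Unary.Linked as Linked
open import Data.List.Relation.Unary.Linked.Properties using (Linked⇒All)
open import Data.List.Relation.Unary.Unique.Propositional using (Unique)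
import Data.List.Relation.Unary.Unique.Propositional.Properties as Unique
open import Data.List.Relation.Binary.BagAndSetEquality using (∼bag⇒↭)
open import Data.List.Relation.Binary.Permutation.Propositional using (_↭_; ↭-refl; ↭-trans; ↭-prep)
import Data.List.Relation.Binary.Permutation.Propositional.Properties as ↭
open import Data.Product using (_×_; _,_)
open import Data.Unit using (⊤; tt)
open import Function.Base using (_∘_)
open import Function.Bundles using (_⇔_; mk⇔; Equivalence)
open import Relation.Nullary using (does)
open import Relation.Binary.PropositionalEquality using (_≡_; refl; sym; trans; cong; cong₂; subst; module ≡-Reasoning)

count : ℕ → List ℕ → ℕ
count k xs = length (filter (_≟ k) xs)

count-++ : ∀ k xs ys → count k (xs ++ ys) ≡ count k xs + count k ys
count-++ k xs ys = trans (cong length (filter-++ (_≟ k) xs ys)) (length-++ (filter (_≟ k) xs))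

count-map-suc : ∀ k xs → count (suc k) (map suc xs) ≡ count k xs
count-map-suc k [] = refl
count-map-suc k (x ∷ xs) with does (x ≟ k)
... | true  = cong suc (count-map-suc k xs)
... | false = count-map-suc k xs

data Pattern : Set where
  leaf : Pattern
  fork : Bool → Pattern → Pattern → Pattern

permute : Pattern → List Tree → List Tree
permute leaf             ts                 = ts
permute (fork _ _ _)     []                 = []
permute (fork false l r) (node a cs ∷ rest) = node a (permute l cs) ∷ permute r rest
permute (fork true  l r) (node a cs ∷ rest) = node a (permute r rest) ∷ permute l cs

invert : Pattern → Pattern
invert leaf             = leaf
invert (fork false l r) = fork false (invert l) (invert r)
invert (fork true  l r) = fork true (invert r) (invert l)

invert-involutive : ∀ s → invert (invert s) ≡ s
invert-involutive leaf             = refl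
invert-involutive (fork false l r) = cong₂ (fork false) (invert-involutive l) (invert-involutive r)
invert-involutive (fork true  l r) = cong₂ (fork true) (invert-involutive l) (invert-involutive r)

permute-inverseˡ : ∀ s ts → permute (invert s) (permute s ts) ≡ ts
permute-inverseˡ leaf             ts                 = refl
permute-inverseˡ (fork false _ _) []                 = refl
permute-inverseˡ (fork true  _ _) []                 = refl
permute-inverseˡ (fork false l r) (node a cs ∷ rest) =
  cong₂ (λ cs′ rest′ → node a cs′ ∷ rest′) (permute-inverseˡ l cs) (permute-inverseˡ r rest)
permute-inverseˡ (fork true  l r) (node a cs ∷ rest) =
  cong₂ (λ cs′ rest′ → node a cs′ ∷ rest′) (permute-inverseˡ l cs) (permute-inverseˡ r rest)

permuteTree : Pattern → Tree → Tree
permuteTree s (node a ts) = node a (permute s ts)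

permuteTree-inverseˡ : ∀ s t → permuteTree (invert s) (permuteTree s t) ≡ t
permuteTree-inverseˡ s (node a ts) = cong (node a) (permute-inverseˡ s ts)

permuteTree-inverseʳ : ∀ s t → permuteTree s (permuteTree (invert s) t) ≡ t
permuteTree-inverseʳ s t =
  subst (λ s′ → permuteTree s′ (permuteTree (invert s) t) ≡ t)
        (invert-involutive s) (permuteTree-inverseˡ (invert s) t)

permuteTree-injective : ∀ s {t u} → permuteTree s t ≡ permuteTree s u → t ≡ u
permuteTree-injective s {t} {u} eq =
  trans (sym (permuteTree-inverseˡ s t)) (trans (cong (permuteTree (invert s)) eq) (permuteTree-inverseˡ s u))

-- Weak increase of a forest hanging below a node labelled b, read in the
-- binary view: every binary node carries a label at least that of its binary parent.
Increasing : ℕ → List Tree → Set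
Increasing b []                 = ⊤
Increasing b (node a cs ∷ rest) = b ≤ a × Increasing a cs × Increasing a rest

permute-Increasing : ∀ s {b} ts → Increasing b ts → Increasing b (permute s ts)
permute-Increasing leaf             ts                 inc               = inc
permute-Increasing (fork _ _ _)     []                 inc               = inc
permute-Increasing (fork false l r) (node a cs ∷ rest) (b≤a , ics , irs) =
  b≤a , permute-Increasing l cs ics , permute-Increasing r rest irs
permute-Increasing (fork true  l r) (node a cs ∷ rest) (b≤a , ics , irs) =
  b≤a , permute-Increasing r rest irs , permute-Increasing l cs ics

WeaklyIncreasing⇒Increasing : ∀ {a ts} → WeaklyIncreasing (node a ts) → Increasing a ts
WeaklyIncreasing⇒Increasing (wi bounded linked subtrees) = increasing bounded linked subtrees
  where
  increasing : ∀ {b ts} → All (λ t → b ≤ label t) ts → Linked _≤_ (map label ts) →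
               All WeaklyIncreasing ts → Increasing b ts
  increasing [] _ [] = tt
  increasing (b≤a ∷ _) linked (wi bounded′ linked′ subtrees′ ∷ rest) =
    b≤a , increasing bounded′ linked′ subtrees′ ,
    increasing (All.map⁻ (All.tail (Linked⇒All ≤-trans ≤-refl linked))) (Linked.tail linked) rest

Increasing⇒bounded : ∀ {b} ts → Increasing b ts → All (λ t → b ≤ label t) ts
Increasing⇒bounded []                 _                 = []
Increasing⇒bounded (node a _ ∷ rest) (b≤a , _ , irest) = b≤a ∷ All.map (≤-trans b≤a) (Increasing⇒bounded rest irest)

Increasing⇒linked : ∀ {b} ts → Increasing b ts → Linked _≤_ (map label ts)
Increasing⇒linked []                            _                  = []
Increasing⇒linked (node a _ ∷ [])               _                  = [-]
Increasing⇒linked (node a _ ∷ node a′ cs ∷ rest) (_ , _ , irest@(a≤a′ , _)) =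
  a≤a′ ∷ Increasing⇒linked (node a′ cs ∷ rest) irest

mutual
  Increasing⇒WeaklyIncreasing : ∀ {a ts} → Increasing a ts → WeaklyIncreasing (node a ts)
  Increasing⇒WeaklyIncreasing {ts = ts} inc =
    wi (Increasing⇒bounded ts inc) (Increasing⇒linked ts inc) (Increasing⇒All ts inc)

  Increasing⇒All : ∀ {b} ts → Increasing b ts → All WeaklyIncreasing ts
  Increasing⇒All []                 _                 = []
  Increasing⇒All (node a cs ∷ rest) (_ , ics , irest) =
    Increasing⇒WeaklyIncreasing ics ∷ Increasing⇒All rest irest

labelsF-permute : ∀ s ts → labelsF (permute s ts) ↭ labelsF ts
labelsF-permute leaf             ts                 = ↭-refl
labelsF-permute (fork _ _ _)     []                 = ↭-refl
labelsF-permute (fork false l r) (node a cs ∷ rest) =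
  ↭-prep a (↭.++⁺ (labelsF-permute l cs) (labelsF-permute r rest))
labelsF-permute (fork true  l r) (node a cs ∷ rest) =
  ↭-prep a (↭-trans (↭.++⁺ (labelsF-permute r rest) (labelsF-permute l cs))
                    (↭.++-comm (labelsF rest) (labelsF cs)))

permuteTree-InTM : ∀ {n p} s t → InTM n p t → InTM n p (permuteTree s t)
permuteTree-InTM s (node a ts) (inc , labels↭) =
  Increasing⇒WeaklyIncreasing (permute-Increasing s ts (WeaklyIncreasing⇒Increasing inc)) ,
  ↭-trans (↭-prep a (labelsF-permute s ts)) labels↭

height : List Tree → ℕ
height []                 = 0
height (node _ cs ∷ rest) = suc (height cs ⊔ height rest)

height≤size : ∀ ts → height ts ≤ length (labelsF ts)
height≤size []                 = z≤n
height≤size (node _ cs ∷ rest) =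
  s≤s (≤-trans (⊔-mono-≤ (height≤size cs) (height≤size rest))
       (≤-trans (m⊔n≤m+n (length (labelsF cs)) (length (labelsF rest))) (≤-reflexive (sym (length-++ (labelsF cs))))))

-- Sum over the complete patterns of depth D; on forests of height at most D
-- these realise every choice of exchanges.
sumPat : ℕ → (Pattern → ℕ) → ℕ
sumPat zero    f = f leaf
sumPat (suc D) f = sumPat D λ l → sumPat D λ r → f (fork false l r) + f (fork true l r)

#patterns : ℕ → ℕ
#patterns D = sumPat D (λ _ → 1)

sumPat-cong : ∀ D {f g : Pattern → ℕ} → (∀ s → f s ≡ g s) → sumPat D f ≡ sumPat D g
sumPat-cong zero    eq = eq leaf
sumPat-cong (suc D) eq =
  sumPat-cong D λ l → sumPat-cong D λ r → cong₂ _+_ (eq (fork false l r)) (eq (fork true l r))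

sumPat-+ : ∀ D (f g : Pattern → ℕ) → sumPat D (λ s → f s + g s) ≡ sumPat D f + sumPat D g
sumPat-+ zero    f g = refl
sumPat-+ (suc D) f g =
  trans (sumPat-cong D λ l →
           trans (sumPat-cong D λ r → interchange +-commutativeSemigroup
                                        (f (fork false l r)) (g (fork false l r))
                                        (f (fork true l r)) (g (fork true l r)))
                 (sumPat-+ D _ _))
        (sumPat-+ D _ _)

sumPat-* : ∀ D k (f : Pattern → ℕ) → sumPat D (λ s → k * f s) ≡ k * sumPat D f
sumPat-* zero    k f = refl
sumPat-* (suc D) k f =
  trans (sumPat-cong D λ l →
           trans (sumPat-cong D λ r → sym (*-distribˡ-+ k _ _)) (sumPat-* D k _))
        (sumPat-* D k _)

sumPat-const : ∀ D k → sumPat D (λ _ → k) ≡ k * #patterns D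
sumPat-const D k = trans (sumPat-cong D λ _ → sym (*-identityʳ k)) (sumPat-* D k (λ _ → 1))

sumPat-split : ∀ D (u v : Pattern → ℕ) →
  sumPat D (λ l → sumPat D (λ r → u l + v r)) ≡ #patterns D * sumPat D u + #patterns D * sumPat D v
sumPat-split D u v = begin
  sumPat D (λ l → sumPat D (λ r → u l + v r))     ≡⟨ sumPat-cong D (λ l → sumPat-+ D (λ _ → u l) v) ⟩
  sumPat D (λ l → sumPat D (λ _ → u l) + V)       ≡⟨ sumPat-+ D _ _ ⟩
  sumPat D (λ l → sumPat D (λ _ → u l)) + sumPat D (λ _ → V)
    ≡⟨ cong₂ _+_ (sumPat-cong D (λ l → trans (sumPat-const D (u l)) (*-comm (u l) P))) (sumPat-const D V) ⟩
  sumPat D (λ l → P * u l) + V * P                ≡⟨ cong₂ _+_ (sumPat-* D P u) (*-comm V P) ⟩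
  P * sumPat D u + P * V                          ∎
  where
  open ≡-Reasoning
  P V : ℕ
  P = #patterns D
  V = sumPat D v

sumPat-positive : ∀ D (f : Pattern → ℕ) → (∀ s → 1 ≤ f s) → 1 ≤ sumPat D f
sumPat-positive zero    f pos = pos leaf
sumPat-positive (suc D) f pos =
  sumPat-positive D _ λ l → sumPat-positive D _ λ r → ≤-trans (pos (fork false l r)) (m≤m+n _ _)

sumPat-sum : ∀ {A : Set} D (h : Pattern → A → ℕ) xs →
  sumPat D (λ s → sum (map (h s) xs)) ≡ sum (map (λ x → sumPat D (λ s → h s x)) xs)
sumPat-sum D h []       = sumPat-const D 0
sumPat-sum D h (x ∷ xs) = trans (sumPat-+ D _ _) (cong (sumPat D (λ s → h s x) +_) (sumPat-sum D h xs))

sum-map-* : ∀ {A : Set} k (f : A → ℕ) xs → sum (map (λ x → k * f x) xs) ≡ k * sum (map f xs)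
sum-map-* k f []       = sym (*-comm k 0)
sum-map-* k f (x ∷ xs) = trans (cong (k * f x +_) (sum-map-* k f xs)) (sym (*-distribˡ-+ k _ _))

lengthIs : ℕ → List Tree → ℕ
lengthIs k ts = count k [ length ts ]

lengthIs-∷ : ∀ k t ts → lengthIs (suc k) (t ∷ ts) ≡ lengthIs k ts
lengthIs-∷ k t ts = count-map-suc k [ length ts ]

degreeCount : ℕ → List Tree → ℕ
degreeCount k ts = count k (degreesF ts)

degreeCount-∷ : ∀ k a cs rest →
  degreeCount k (node a cs ∷ rest) ≡ (lengthIs k cs + degreeCount k cs) + degreeCount k rest
degreeCount-∷ k a cs rest =
  trans (count-++ k (length cs ∷ degreesF cs) (degreesF rest))
        (cong (_+ degreeCount k rest) (count-++ k [ length cs ] (degreesF cs)))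

sumPat-degreeCount : ∀ D k ts → height ts ≤ D →
  sumPat D (λ s → degreeCount k (permute s ts)) ≡
  sumPat D (λ s → lengthIs (suc k) (permute s ts) + 2 * degreeCount (suc k) (permute s ts))
sumPat-degreeCount D k [] _ = sumPat-cong D at-[]
  where
  at-[] : ∀ s → degreeCount k (permute s []) ≡
                lengthIs (suc k) (permute s []) + 2 * degreeCount (suc k) (permute s [])
  at-[] leaf         = refl
  at-[] (fork _ _ _) = refl
sumPat-degreeCount (suc D) k (node a A ∷ B) (s≤s h) = begin
  sumPat D (λ l → sumPat D (λ r → C k (node a (A′ l) ∷ B′ r) + C k (node a (B′ r) ∷ A′ l)))
    ≡⟨ sumPat-cong D (λ l → sumPat-cong D (λ r → both-ways (A′ l) (B′ r))) ⟩
  sumPat D (λ l → sumPat D (λ r → u (A′ l) + u (B′ r)))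
    ≡⟨ sumPat-split D (u ∘ A′) (u ∘ B′) ⟩
  P * sumPat D (u ∘ A′) + P * sumPat D (u ∘ B′)
    ≡⟨ cong₂ (λ x y → P * x + P * y) (sumPat-u≡u′ A (m⊔n≤o⇒m≤o _ _ h)) (sumPat-u≡u′ B (m⊔n≤o⇒n≤o _ _ h)) ⟩
  P * sumPat D (u′ ∘ A′) + P * sumPat D (u′ ∘ B′)
    ≡⟨ sumPat-split D (u′ ∘ A′) (u′ ∘ B′) ⟨
  sumPat D (λ l → sumPat D (λ r → u′ (A′ l) + u′ (B′ r)))
    ≡⟨ sumPat-cong D (λ l → sumPat-cong D (λ r → both-ways′ (A′ l) (B′ r))) ⟨
  sumPat D (λ l → sumPat D (λ r → v (node a (A′ l) ∷ B′ r) + v (node a (B′ r) ∷ A′ l))) ∎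
  where
  open ≡-Reasoning
  C = degreeCount
  P = #patterns D
  A′ B′ : Pattern → List Tree
  A′ l = permute l A
  B′ r = permute r B
  u u′ v : List Tree → ℕ
  u  X = lengthIs k X + 2 * C k X
  u′ X = lengthIs k X + 2 * (lengthIs (suc k) X + 2 * C (suc k) X)
  v  X = lengthIs (suc k) X + 2 * C (suc k) X

  both-ways : ∀ X Y → C k (node a X ∷ Y) + C k (node a Y ∷ X) ≡ u X + u Y
  both-ways X Y rewrite degreeCount-∷ k a X Y | degreeCount-∷ k a Y X =
    arith (lengthIs k X) (C k X) (lengthIs k Y) (C k Y)
    where
    arith : ∀ ℓX cX ℓY cY → ((ℓX + cX) + cY) + ((ℓY + cY) + cX) ≡ (ℓX + 2 * cX) + (ℓY + 2 * cY)
    arith = solve-∀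

  both-ways′ : ∀ X Y → v (node a X ∷ Y) + v (node a Y ∷ X) ≡ u′ X + u′ Y
  both-ways′ X Y rewrite degreeCount-∷ (suc k) a X Y | degreeCount-∷ (suc k) a Y X
                       | lengthIs-∷ k (node a X) Y | lengthIs-∷ k (node a Y) X =
    arith (lengthIs k X) (lengthIs (suc k) X) (C (suc k) X) (lengthIs k Y) (lengthIs (suc k) Y) (C (suc k) Y)
    where
    arith : ∀ ℓX ℓ′X cX ℓY ℓ′Y cY →
      (ℓY + 2 * ((ℓ′X + cX) + cY)) + (ℓX + 2 * ((ℓ′Y + cY) + cX)) ≡
      (ℓX + 2 * (ℓ′X + 2 * cX)) + (ℓY + 2 * (ℓ′Y + 2 * cY))
    arith = solve-∀

  sumPat-u≡u′ : ∀ Z → height Z ≤ D → sumPat D (λ l → u (permute l Z)) ≡ sumPat D (λ l → u′ (permute l Z))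
  sumPat-u≡u′ Z hZ =
    trans (sumPat-+ D _ _)
   (trans (cong (sumPat D (λ l → lengthIs k (permute l Z)) +_)
                (trans (sumPat-* D 2 _) (trans (cong (2 *_) (sumPat-degreeCount D k Z hZ)) (sym (sumPat-* D 2 _)))))
          (sym (sumPat-+ D _ _)))

#fullDeg-node : ∀ k a ts → #fullDeg (suc k) (node a ts) ≡ lengthIs (suc k) ts + degreeCount k ts
#fullDeg-node k a ts =
  trans (count-++ (suc k) [ length ts ] (map suc (degreesF ts)))
        (cong (lengthIs (suc k) ts +_) (count-map-suc k (degreesF ts)))

#deg-node : ∀ k a ts → #deg k (node a ts) ≡ lengthIs k ts + degreeCount k ts
#deg-node k a ts = count-++ k [ length ts ] (degreesF ts)

sumPat-#fullDeg : ∀ D k t → height (children t) ≤ D →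
  sumPat D (λ s → #fullDeg (suc k) (permuteTree s t)) ≡ sumPat D (λ s → 2 * #deg (suc k) (permuteTree s t))
sumPat-#fullDeg D k (node a ts) h = begin
  sumPat D (λ s → #fullDeg (suc k) (node a (permute s ts)))  ≡⟨ sumPat-cong D (λ s → #fullDeg-node k a (permute s ts)) ⟩
  sumPat D (λ s → L s + degreeCount k (permute s ts))        ≡⟨ sumPat-+ D L _ ⟩
  ΣL + sumPat D (λ s → degreeCount k (permute s ts))         ≡⟨ cong (ΣL +_) (sumPat-degreeCount D k ts h) ⟩
  ΣL + sumPat D (λ s → L s + 2 * C s)                        ≡⟨ cong (ΣL +_) (trans (sumPat-+ D L _) (cong (ΣL +_) (sumPat-* D 2 C))) ⟩
  ΣL + (ΣL + 2 * ΣC)                                         ≡⟨ arith ΣL ΣC ⟩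
  2 * (ΣL + ΣC)                                              ≡⟨ cong (2 *_) (sumPat-+ D L C) ⟨
  2 * sumPat D (λ s → L s + C s)                             ≡⟨ sumPat-* D 2 _ ⟨
  sumPat D (λ s → 2 * (L s + C s))                           ≡⟨ sumPat-cong D (λ s → cong (2 *_) (#deg-node (suc k) a (permute s ts))) ⟨
  sumPat D (λ s → 2 * #deg (suc k) (node a (permute s ts)))  ∎
  where
  open ≡-Reasoning
  L C : Pattern → ℕ
  L s = lengthIs (suc k) (permute s ts)
  C s = degreeCount (suc k) (permute s ts)
  ΣL ΣC : ℕ
  ΣL = sumPat D L
  ΣC = sumPat D C
  arith : ∀ ℓ c → ℓ + (ℓ + 2 * c) ≡ 2 * (ℓ + c)
  arith = solve-∀

module _ {X : List Tree} (unique : Unique X) (closed : ∀ s {t} → t ∈ X → permuteTree s t ∈ X) where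

  map-permuteTree-↭ : ∀ s → map (permuteTree s) X ↭ X
  map-permuteTree-↭ s = ∼bag⇒↭ (unique∧set⇒bag (Unique.map⁺ (permuteTree-injective s) unique) unique
                                                 (mk⇔ image⊆X X⊆image))
    where
    image⊆X : ∀ {t} → t ∈ map (permuteTree s) X → t ∈ X
    image⊆X t∈ with ∈-map⁻ (permuteTree s) t∈
    ... | _ , u∈ , refl = closed s u∈
    X⊆image : ∀ {t} → t ∈ X → t ∈ map (permuteTree s) X
    X⊆image {t} t∈ = subst (_∈ map (permuteTree s) X) (permuteTree-inverseʳ s t)
                           (∈-map⁺ (permuteTree s) (closed (invert s) t∈))

  sum-map-permuteTree : ∀ s (f : Tree → ℕ) → sum (map (f ∘ permuteTree s) X) ≡ sum (map f X)
  sum-map-permuteTree s f = trans (cong sum (map-∘ X)) (sum-↭ (↭.map⁺ f (map-permuteTree-↭ s)))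

  #patterns*sum : ∀ D (f : Tree → ℕ) →
    #patterns D * sum (map f X) ≡ sum (map (λ t → sumPat D (λ s → f (permuteTree s t))) X)
  #patterns*sum D f = begin
    #patterns D * sum (map f X)                       ≡⟨ *-comm (#patterns D) _ ⟩
    sum (map f X) * #patterns D                       ≡⟨ sumPat-const D _ ⟨
    sumPat D (λ _ → sum (map f X))                    ≡⟨ sumPat-cong D (λ s → sum-map-permuteTree s f) ⟨
    sumPat D (λ s → sum (map (f ∘ permuteTree s) X))  ≡⟨ sumPat-sum D _ X ⟩
    sum (map (λ t → sumPat D (λ s → f (permuteTree s t))) X) ∎
    where open ≡-Reasoning

  sum-≡-byOrbits : ∀ D (f g : Tree → ℕ) →
    (∀ {t} → t ∈ X → sumPat D (λ s → f (permuteTree s t)) ≡ sumPat D (λ s → g (permuteTree s t))) →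
    sum (map f X) ≡ sum (map g X)
  sum-≡-byOrbits D f g orbits = *-cancelˡ-≡ _ _ (#patterns D) {{#patterns-nonZero}}
    (trans (#patterns*sum D f)
    (trans (cong sum (map-cong-local (All.tabulate orbits)))
           (sym (#patterns*sum D g))))
    where
    #patterns-nonZero : NonZero (#patterns D)
    #patterns-nonZero = >-nonZero (sumPat-positive D _ (λ _ → ≤-refl))

sum-#fullDeg≡2*sum-#deg : ∀ n p k (TM : List Tree) → Unique TM → (∀ T → (T ∈ TM) ⇔ InTM n p T) →
  sum (map (#fullDeg (suc k)) TM) ≡ 2 * sum (map (#deg (suc k)) TM)
sum-#fullDeg≡2*sum-#deg n p k TM unique TM-spec =
  trans (sum-≡-byOrbits unique closed (length (multiset n p)) _ _ orbits)
        (sum-map-* 2 (#deg (suc k)) TM)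
  where
  open Equivalence
  closed : ∀ s {t} → t ∈ TM → permuteTree s t ∈ TM
  closed s {t} t∈ = from (TM-spec _) (permuteTree-InTM {n} {p} s t (to (TM-spec t) t∈))
  orbits : ∀ {t} → t ∈ TM → sumPat (length (multiset n p)) (λ s → #fullDeg (suc k) (permuteTree s t)) ≡
                              sumPat (length (multiset n p)) (λ s → 2 * #deg (suc k) (permuteTree s t))
  orbits {node a ts} t∈ with to (TM-spec _) t∈
  ... | _ , labels↭ = sumPat-#fullDeg _ k (node a ts)
                        (subst (height ts ≤_) (suc-injective (↭.↭-length labels↭)) (height≤size ts))

theorem2p9 : (n : ℕ) (p : Fin n → ℕ) → (∀ i → 1 ≤ p i) → (d : ℕ) →
    (TM : List Tree) → Unique TM → (∀ T → (T ∈ TM) ⇔ InTM n p T) →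
    sum (map (#fullDeg (2 * d + 1)) TM) ≡ 2 * sum (map (#deg (2 * d + 1)) TM)
theorem2p9 n p _ d TM unique TM-spec =
  subst (λ k → sum (map (#fullDeg k) TM) ≡ 2 * sum (map (#deg k) TM))
        (+-comm 1 (2 * d)) (sum-#fullDeg≡2*sum-#deg n p (2 * d) TM unique TM-spec)
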